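{- Let $n\ge1$. Consider the map $\Phi$ sending a tuple $(A_1,\dots,A_4)$ of subsets of $[n]$ to $(S_1,\dots,S_4,M)$ with $M=\bigcap_{i=1}^4A_i$ and $S_i=(A_i\cap A_{i+1})\setminus M$, and the map $\Psi$ sending a tuple $(S_1,\dots,S_4,M)$ to $(A_1,\dots,A_4)$ with $A_i=M\cup S_{i-1}\cup S_i$ (all indices mod 4). Then: (a) for every tuple $(A_1,\dots,A_4)$ of pairwise distinct nonempty subsets of $[n]$ with $\chi_{A_1}+\chi_{A_3}=\chi_{A_2}+\chi_{A_4}$ and $A_i\cap A_j\ne\emptyset$ for all $i\ne j$, one has $\Psi(\Phi(A_1,\dots,A_4))=(A_1,\dots,A_4)$; (b) for every side-midpoint tuple $(S_1,\dots,S_4,M)$ of subsets of $[n]$, one has $\Phi(\Psi(S_1,\dots,S_4,M))=(S_1,\dots,S_4,M)$.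
   Context: A side-midpoint tuple of subsets of $[n]$ is a tuple $(S_1,S_2,S_3,S_4,M)$ of subsets of $[n]$ such that $S_i\cap S_j=\emptyset$ for all $i\ne j$; $M\cap S_i=\emptyset$ for all $i$; $M\ne\emptyset$; and not both $S_1,S_3$ are empty and not both $S_2,S_4$ are empty. $\chi_A$ denotes the characteristic vector of $A\subseteq[n]$. -}

module Defs where

open import Data.Nat using (ℕ; _+_; _≥_)
open import Data.Bool using (Bool; true; false)
open import Data.Fin using (Fin)
open import Data.Fin.Subset using (Subset; _∩_; _∪_; _─_; Nonempty; Empty)
open import Data.Vec using (lookup)
open import Data.Product using (_×_; _,_)
open import Relation.Binary.PropositionalEquality using (_≡_)
open import Relation.Nullary using (¬_)

-- A 4-tuple of subsets of [n] = {0,…,n-1} (Fin n), represented by Data.Fin.Subset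
Quad : ℕ → Set
Quad n = Subset n × Subset n × Subset n × Subset n

Quint : ℕ → Set
Quint n = Subset n × Subset n × Subset n × Subset n × Subset n

χ : ∀ {n} → Subset n → Fin n → ℕ
χ A i with lookup A i
... | true  = 1
... | false = 0

Φ : ∀ {n} → Quad n → Quint n
Φ (A₁ , A₂ , A₃ , A₄) =
  let M = A₁ ∩ A₂ ∩ A₃ ∩ A₄ in
  ((A₁ ∩ A₂) ─ M , (A₂ ∩ A₃) ─ M , (A₃ ∩ A₄) ─ M , (A₄ ∩ A₁) ─ M , M)

Ψ : ∀ {n} → Quint n → Quad n
Ψ (S₁ , S₂ , S₃ , S₄ , M) =
  (M ∪ S₄ ∪ S₁ , M ∪ S₁ ∪ S₂ , M ∪ S₂ ∪ S₃ , M ∪ S₃ ∪ S₄)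

Disjoint : ∀ {n} → Subset n → Subset n → Set
Disjoint A B = Empty (A ∩ B)

SideMidpoint : ∀ {n} → Quint n → Set
SideMidpoint (S₁ , S₂ , S₃ , S₄ , M) =
  Disjoint S₁ S₂ × Disjoint S₁ S₃ × Disjoint S₁ S₄ ×
  Disjoint S₂ S₃ × Disjoint S₂ S₄ × Disjoint S₃ S₄ ×
  Disjoint M S₁ × Disjoint M S₂ × Disjoint M S₃ × Disjoint M S₄ ×
  Nonempty M ×
  ¬ (Empty S₁ × Empty S₃) × ¬ (Empty S₂ × Empty S₄)

GoodQuad : ∀ {n} → Quad n → Set
GoodQuad (A₁ , A₂ , A₃ , A₄) =
  ¬ A₁ ≡ A₂ × ¬ A₁ ≡ A₃ × ¬ A₁ ≡ A₄ × ¬ A₂ ≡ A₃ × ¬ A₂ ≡ A₄ × ¬ A₃ ≡ A₄ ×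
  Nonempty A₁ × Nonempty A₂ × Nonempty A₃ × Nonempty A₄ ×
  (∀ i → χ A₁ i + χ A₃ i ≡ χ A₂ i + χ A₄ i) ×
  Nonempty (A₁ ∩ A₂) × Nonempty (A₁ ∩ A₃) × Nonempty (A₁ ∩ A₄) ×
  Nonempty (A₂ ∩ A₃) × Nonempty (A₂ ∩ A₄) × Nonempty (A₃ ∩ A₄)

module Submission where

-- Φ and Ψ are built from the set operations ∩, ∪ and ─, which act on the
-- characteristic vectors of subsets of [n] one point at a time.  Hence both
-- Ψ ∘ Φ and Φ ∘ Ψ are computed pointwise, and each identity of the theorem
-- follows, by induction on n, from its instance on a one-point ground set
-- [1] together with a pointwise form of its hypothesis:
--   (a) needs only the balance condition χ_{A₁} + χ_{A₃} = χ_{A₂} + χ_{A₄};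
--       at a single point it says the point lies in A₁,A₂ / A₂,A₃ / A₃,A₄ /
--       A₄,A₁ / all four / none of the Aᵢ, and Ψ ∘ Φ fixes each of these;
--   (b) needs only the ten disjointness conditions; at a single point they
--       say the point lies in at most one of S₁,…,S₄,M, and Φ ∘ Ψ fixes each
--       of these configurations.

open import Defs
open import Data.Nat using (ℕ; _≥_; _+_)
open import Data.Bool using (Bool; true; false; _∧_)
open import Data.Fin using (Fin; zero; suc)
open import Data.Fin.Subset using (Subset; _∩_)
open import Data.Vec using (_∷_; []; lookup)
open import Data.Vec.Properties using (lookup-zipWith; lookup⇒[]=)
open import Data.Product using (_×_; _,_)
open import Data.Empty using (⊥-elim)
open import Function using (_∘_)
open import Relation.Binary.PropositionalEquality using (_≡_; refl; trans; cong₂)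

private
  variable
    n : ℕ

infixr 5 _∷₄_ _∷₅_

_∷₄_ : Quad 1 → Quad n → Quad (ℕ.suc n)
(x₁ ∷ [] , x₂ ∷ [] , x₃ ∷ [] , x₄ ∷ []) ∷₄ (A₁ , A₂ , A₃ , A₄) =
  (x₁ ∷ A₁ , x₂ ∷ A₂ , x₃ ∷ A₃ , x₄ ∷ A₄)

_∷₅_ : Quint 1 → Quint n → Quint (ℕ.suc n)
(x₁ ∷ [] , x₂ ∷ [] , x₃ ∷ [] , x₄ ∷ [] , y ∷ []) ∷₅ (S₁ , S₂ , S₃ , S₄ , M) =
  (x₁ ∷ S₁ , x₂ ∷ S₂ , x₃ ∷ S₃ , x₄ ∷ S₄ , y ∷ M)

Balanced : Quad n → Set
Balanced {n} (A₁ , A₂ , A₃ , A₄) = (i : Fin n) → χ A₁ i + χ A₃ i ≡ χ A₂ i + χ A₄ i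

ΨΦ-point : (x₁ x₂ x₃ x₄ : Bool) → Balanced (x₁ ∷ [] , x₂ ∷ [] , x₃ ∷ [] , x₄ ∷ []) →
  Ψ (Φ (x₁ ∷ [] , x₂ ∷ [] , x₃ ∷ [] , x₄ ∷ [])) ≡ (x₁ ∷ [] , x₂ ∷ [] , x₃ ∷ [] , x₄ ∷ [])
ΨΦ-point true  true  true  true  _ = refl
ΨΦ-point true  true  false false _ = refl
ΨΦ-point false true  true  false _ = refl
ΨΦ-point false false true  true  _ = refl
ΨΦ-point true  false false true  _ = refl
ΨΦ-point false false false false _ = refl
ΨΦ-point true  true  true  false b with () ← b zero
ΨΦ-point true  true  false true  b with () ← b zero
ΨΦ-point true  false true  true  b with () ← b zero
ΨΦ-point false true  true  true  b with () ← b zero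
ΨΦ-point true  false true  false b with () ← b zero
ΨΦ-point false true  false true  b with () ← b zero
ΨΦ-point true  false false false b with () ← b zero
ΨΦ-point false true  false false b with () ← b zero
ΨΦ-point false false true  false b with () ← b zero
ΨΦ-point false false false true  b with () ← b zero

ΨΦ-balanced : (A : Quad n) → Balanced A → Ψ (Φ A) ≡ A
ΨΦ-balanced ([] , [] , [] , []) _ = refl
ΨΦ-balanced (x₁ ∷ A₁ , x₂ ∷ A₂ , x₃ ∷ A₃ , x₄ ∷ A₄) b =
  cong₂ _∷₄_ (ΨΦ-point x₁ x₂ x₃ x₄ (λ { zero → b zero }))
             (ΨΦ-balanced (A₁ , A₂ , A₃ , A₄) (b ∘ suc))

disjoint-at : (A B : Subset n) → Disjoint A B → (i : Fin n) → lookup A i ∧ lookup B i ≡ false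
disjoint-at A B d i with lookup A i ∧ lookup B i in both
... | false = refl
... | true  = ⊥-elim (d (i , lookup⇒[]= i (A ∩ B) (trans (lookup-zipWith _∧_ i A B) both)))

record Exclusive (s₁ s₂ s₃ s₄ m : Bool) : Set where
  field
    s₁s₂ : s₁ ∧ s₂ ≡ false
    s₁s₃ : s₁ ∧ s₃ ≡ false
    s₁s₄ : s₁ ∧ s₄ ≡ false
    s₂s₃ : s₂ ∧ s₃ ≡ false
    s₂s₄ : s₂ ∧ s₄ ≡ false
    s₃s₄ : s₃ ∧ s₄ ≡ false
    ms₁  : m ∧ s₁ ≡ false
    ms₂  : m ∧ s₂ ≡ false
    ms₃  : m ∧ s₃ ≡ false
    ms₄  : m ∧ s₄ ≡ false

exclusive-at : ((S₁ , S₂ , S₃ , S₄ , M) : Quint n) → SideMidpoint (S₁ , S₂ , S₃ , S₄ , M) →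
  (i : Fin n) → Exclusive (lookup S₁ i) (lookup S₂ i) (lookup S₃ i) (lookup S₄ i) (lookup M i)
exclusive-at (S₁ , S₂ , S₃ , S₄ , M) (d₁₂ , d₁₃ , d₁₄ , d₂₃ , d₂₄ , d₃₄ , d₁ , d₂ , d₃ , d₄ , _) i =
  record
    { s₁s₂ = disjoint-at S₁ S₂ d₁₂ i ; s₁s₃ = disjoint-at S₁ S₃ d₁₃ i
    ; s₁s₄ = disjoint-at S₁ S₄ d₁₄ i ; s₂s₃ = disjoint-at S₂ S₃ d₂₃ i
    ; s₂s₄ = disjoint-at S₂ S₄ d₂₄ i ; s₃s₄ = disjoint-at S₃ S₄ d₃₄ i
    ; ms₁  = disjoint-at M S₁ d₁ i   ; ms₂  = disjoint-at M S₂ d₂ i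
    ; ms₃  = disjoint-at M S₃ d₃ i   ; ms₄  = disjoint-at M S₄ d₄ i
    }

ΦΨ-point : (s₁ s₂ s₃ s₄ m : Bool) → Exclusive s₁ s₂ s₃ s₄ m →
  Φ (Ψ (s₁ ∷ [] , s₂ ∷ [] , s₃ ∷ [] , s₄ ∷ [] , m ∷ [])) ≡ (s₁ ∷ [] , s₂ ∷ [] , s₃ ∷ [] , s₄ ∷ [] , m ∷ [])
ΦΨ-point true  _     _     _     true  record { ms₁ = () }
ΦΨ-point false true  _     _     true  record { ms₂ = () }
ΦΨ-point false false true  _     true  record { ms₃ = () }
ΦΨ-point false false false true  true  record { ms₄ = () }
ΦΨ-point false false false false true  _ = refl
ΦΨ-point true  true  _     _     false record { s₁s₂ = () }
ΦΨ-point true  false true  _     false record { s₁s₃ = () }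
ΦΨ-point true  false false true  false record { s₁s₄ = () }
ΦΨ-point true  false false false false _ = refl
ΦΨ-point false true  true  _     false record { s₂s₃ = () }
ΦΨ-point false true  false true  false record { s₂s₄ = () }
ΦΨ-point false true  false false false _ = refl
ΦΨ-point false false true  true  false record { s₃s₄ = () }
ΦΨ-point false false true  false false _ = refl
ΦΨ-point false false false true  false _ = refl
ΦΨ-point false false false false false _ = refl

ΦΨ-exclusive : ((S₁ , S₂ , S₃ , S₄ , M) : Quint n) →
  ((i : Fin n) → Exclusive (lookup S₁ i) (lookup S₂ i) (lookup S₃ i) (lookup S₄ i) (lookup M i)) →
  Φ (Ψ (S₁ , S₂ , S₃ , S₄ , M)) ≡ (S₁ , S₂ , S₃ , S₄ , M)
ΦΨ-exclusive ([] , [] , [] , [] , []) _ = refl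
ΦΨ-exclusive (s₁ ∷ S₁ , s₂ ∷ S₂ , s₃ ∷ S₃ , s₄ ∷ S₄ , m ∷ M) e =
  cong₂ _∷₅_ (ΦΨ-point s₁ s₂ s₃ s₄ m (e zero))
             (ΦΨ-exclusive (S₁ , S₂ , S₃ , S₄ , M) (e ∘ suc))

proposition7p9 : (n : ℕ) → n ≥ 1 →
    ((A : Quad n) → GoodQuad A → Ψ (Φ A) ≡ A) ×
    ((T : Quint n) → SideMidpoint T → Φ (Ψ T) ≡ T)
proposition7p9 n _ = partA , partB
  where
  partA : (A : Quad n) → GoodQuad A → Ψ (Φ A) ≡ A
  partA A (_ , _ , _ , _ , _ , _ , _ , _ , _ , _ , balanced , _) = ΨΦ-balanced A balanced

  partB : (T : Quint n) → SideMidpoint T → Φ (Ψ T) ≡ T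
  partB T sideMidpoint = ΦΨ-exclusive T (exclusive-at T sideMidpoint)
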